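{- Let $n\geq 2$ and $I,J\subseteq[n-1]$ with $I\neq J$. There exist $u\in\mathfrak{D}_I$ and $v\in\mathfrak{D}_J$ such that $u\lessdot v$ or $v\lessdot u$ in the left weak order if and only if either ($I\subseteq J$ and $\#I=\#J-1$) or ($J\subseteq I$ and $\#J=\#I-1$).
   Context: For $\sigma\in\mathfrak{S}_n$ (written as the word $\sigma_1\cdots\sigma_n$), $\mathrm{Des}(\sigma)=\{i\in[n-1]:\sigma_i>\sigma_{i+1}\}$, and the descent class $\mathfrak{D}_I$ is $\{\sigma:\mathrm{Des}(\sigma)=I\}$. Let $s_i=(i,i+1)$ and $(s_i\sigma)(j)=s_i(\sigma(j))$ (so $s_i\sigma$ swaps the values $i$ and $i+1$ in the word of $\sigma$). The left weak order has cover relations $\sigma\lessdot s_i\sigma$ whenever $i$ appears to the left of $i+1$ in $\sigma$. -}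

module Defs where

open import Data.Nat using (ℕ; suc)
open import Data.Fin using (Fin; suc; inject₁; _<_; _>_)
open import Data.Fin.Subset using (Subset; _∈_)
open import Data.Fin.Permutation using (Permutation′; _⟨$⟩ʳ_; _⟨$⟩ˡ_)
import Data.Fin.Permutation.Components as PC
open import Data.Product using (Σ; _×_)
open import Relation.Binary.PropositionalEquality using (_≡_)

-- Conventions: n = suc m, so 𝔖ₙ = Permutation′ (suc m), with the word of σ
-- being σ(0) σ(1) ... σ(m) (positions and values 0-indexed).
-- [n-1] = {1,...,m} is encoded as Fin m: index i : Fin m stands for i+1,
-- i.e. the adjacent pair of positions (inject₁ i , suc i), and likewise
-- for values: s_{i+1} swaps the values inject₁ i and suc i.

IsDescent : ∀ {m} → Permutation′ (suc m) → Fin m → Set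
IsDescent σ i = σ ⟨$⟩ʳ inject₁ i > σ ⟨$⟩ʳ suc i

InDescentClass : ∀ {m} → Subset m → Permutation′ (suc m) → Set
InDescentClass {m} I σ = (i : Fin m) → (i ∈ I → IsDescent σ i) × (IsDescent σ i → i ∈ I)

-- Left weak order cover σ ⋖ τ: there is i such that the value i appears to
-- the left of the value i+1 in σ, and τ = s_i σ (swap the values i, i+1).
_⋖_ : ∀ {m} → Permutation′ (suc m) → Permutation′ (suc m) → Set
_⋖_ {m} σ τ = Σ (Fin m) λ i →
  (σ ⟨$⟩ˡ inject₁ i < σ ⟨$⟩ˡ suc i) ×
  ((j : Fin (suc m)) → τ ⟨$⟩ʳ j ≡ PC.transpose (inject₁ i) (suc i) (σ ⟨$⟩ʳ j))

module Submission where

-- Swapping the values x and x + 1 of a word (σ ↦ s_x σ) preserves the relative order of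
-- every pair of values other than {x, x + 1}. So if σ ⋖ s_x σ, the descent sets of σ and
-- s_x σ can differ only at a position p where x, x + 1 stand next to each other in σ, and
-- there σ ascends while s_x σ descends: either Des σ = Des (s_x σ) or Des (s_x σ) is
-- Des σ plus the point p, which is exactly "I ⊆ J and #I = #J - 1" for I ≠ J.
-- Conversely, let J = I ∪ {p}. Build a word greedily, putting at each position the largest
-- remaining value if the position is to be a descent and the smallest one otherwise. Two
-- equal choices in a row place consecutive values, and I, J agree at p + 1: so in the word
-- built for J (when p + 1 ∈ J or p is the last position) or for I (when p + 1 ∉ I) the
-- positions p, p + 1 hold consecutive values, and swapping them is the required cover.

open import Defs
open import Data.Nat as ℕ using (ℕ; suc; _+_; _≤_; _∸_; s≤s)
import Data.Nat.Properties as ℕ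
open import Data.Unit using (⊤)
open import Data.Fin using (Fin; zero; suc; inject₁; toℕ; fromℕ; punchIn; _<_)
open import Data.Fin.Properties
  using ( _≟_; any?; suc-injective; inject₁-injective; toℕ-inject₁; toℕ-fromℕ; toℕ<n
        ; toℕ-injective; ≤-refl; ≤̄⇒inject₁<; <⇒≢; ≤∧≢⇒<; <-trans; <-asym)
open import Data.Fin.Subset using (Side; inside; outside; Subset; _∈_; _⊆_; ∣_∣; _-_)
open import Data.Fin.Subset.Properties
  using (_∈?_; ⊆-antisym; drop-there; p⊆q⇒∣p∣≤∣q∣; x∈p∧x≢y⇒x∈p-y; x∈p⇒∣p-x∣<∣p∣)
open import Data.Fin.Permutation
  using (Permutation′; _⟨$⟩ʳ_; _⟨$⟩ˡ_; inverseˡ; id; insert; transpose; _∘ₚ_)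
import Data.Fin.Permutation.Components as PC
open import Data.Vec using ([]; _∷_; here; there)
open import Data.Product using (Σ; ∃; _×_; _,_; proj₁; proj₂)
open import Data.Sum using (_⊎_; inj₁; inj₂; [_,_]′)
open import Function.Bundles using (_⇔_; mk⇔)
open import Relation.Nullary using (¬_; Dec; yes; no; ¬?; contradiction)
open import Relation.Nullary.Decidable using (_×-dec_; dec-true; dec-false)
open import Relation.Binary.PropositionalEquality
  using (_≡_; _≢_; ≢-sym; refl; cong; sym; trans; subst; subst₂; module ≡-Reasoning)

private variable
  m n : ℕ
  p : Fin m
  P Q R P′ Q′ : Fin m → Set

infix 4 _≐_ _⋖ᵖ[_]_

-- Unlike Relation.Unary._≐_ the point is explicit, so that InDescentClass A σ is
-- definitionally (_∈ A) ≐ IsDescent σ.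
_≐_ : (P Q : Fin m → Set) → Set
P ≐ Q = ∀ k → (P k → Q k) × (Q k → P k)

_⋖ᵖ[_]_ : (P : Fin m → Set) → Fin m → (Q : Fin m → Set) → Set
P ⋖ᵖ[ p ] Q = ¬ P p × Q p × (∀ k → k ≢ p → (P k → Q k) × (Q k → P k))

≐-refl : P ≐ P
≐-refl k = (λ Pk → Pk) , (λ Pk → Pk)

≐-sym : P ≐ Q → Q ≐ P
≐-sym P≐Q k = proj₂ (P≐Q k) , proj₁ (P≐Q k)

≐-trans : P ≐ Q → Q ≐ R → P ≐ R
≐-trans P≐Q Q≐R k =
  (λ Pk → proj₁ (Q≐R k) (proj₁ (P≐Q k) Pk)) , (λ Rk → proj₂ (P≐Q k) (proj₂ (Q≐R k) Rk))

⋖ᵖ-resp-≐ : P ≐ P′ → Q ≐ Q′ → P ⋖ᵖ[ p ] Q → P′ ⋖ᵖ[ p ] Q′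
⋖ᵖ-resp-≐ {p = p} P≐P′ Q≐Q′ (¬Pp , Qp , agree) =
  (λ P′p → ¬Pp (proj₂ (P≐P′ p) P′p)) , proj₁ (Q≐Q′ p) Qp ,
  λ k k≢p → (λ P′k → proj₁ (Q≐Q′ k) (proj₁ (agree k k≢p) (proj₂ (P≐P′ k) P′k)))
          , (λ Q′k → proj₁ (P≐P′ k) (proj₂ (agree k k≢p) (proj₂ (Q≐Q′ k) Q′k)))

⋖ᵖ-determinesʳ : P ⋖ᵖ[ p ] Q → P ⋖ᵖ[ p ] Q′ → Q ≐ Q′
⋖ᵖ-determinesʳ {p = p} (_ , Qp , agree) (_ , Q′p , agree′) k with k ≟ p
... | yes refl = (λ _ → Q′p) , (λ _ → Qp)
... | no k≢p   = (λ Qk → proj₁ (agree′ k k≢p) (proj₂ (agree k k≢p) Qk))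
               , (λ Q′k → proj₁ (agree k k≢p) (proj₂ (agree′ k k≢p) Q′k))

⋖ᵖ-determinesˡ : P ⋖ᵖ[ p ] Q → P′ ⋖ᵖ[ p ] Q → P ≐ P′
⋖ᵖ-determinesˡ {p = p} (¬Pp , _ , agree) (¬P′p , _ , agree′) k with k ≟ p
... | yes refl = (λ Pp → contradiction Pp ¬Pp) , (λ P′p → contradiction P′p ¬P′p)
... | no k≢p   = (λ Pk → proj₂ (agree′ k k≢p) (proj₁ (agree k k≢p) Pk))
               , (λ P′k → proj₂ (agree k k≢p) (proj₁ (agree′ k k≢p) P′k))

≐⇒≡ : {A B : Subset m} → (_∈ A) ≐ (_∈ B) → A ≡ B
≐⇒≡ A≐B = ⊆-antisym (λ {k} → proj₁ (A≐B k)) (λ {k} → proj₂ (A≐B k))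

⋖ᵖ⇒⊆ : {A B : Subset m} → (_∈ A) ⋖ᵖ[ p ] (_∈ B) → A ⊆ B
⋖ᵖ⇒⊆ {p = p} (p∉A , _ , agree) {k} k∈A with k ≟ p
... | yes refl = contradiction k∈A p∉A
... | no k≢p   = proj₁ (agree k k≢p) k∈A

⋖ᵖ-zero : ∀ {a b} {A B : Subset m} → (_∈ a ∷ A) ⋖ᵖ[ zero ] (_∈ b ∷ B) →
          a ≡ outside × b ≡ inside × A ≡ B
⋖ᵖ-zero {a = inside}  (0∉A , _ , _)      = contradiction here 0∉A
⋖ᵖ-zero {a = outside} (_ , here , agree) = refl , refl , ≐⇒≡ λ k →
  let agreeₖ = agree (suc k) λ () in
  (λ k∈A → drop-there (proj₁ agreeₖ (there k∈A))) , (λ k∈B → drop-there (proj₂ agreeₖ (there k∈B)))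

⋖ᵖ-head : ∀ {a b} {A B : Subset m} → (_∈ a ∷ A) ⋖ᵖ[ suc p ] (_∈ b ∷ B) → a ≡ b
⋖ᵖ-head {a = inside}  {b = inside}  _ = refl
⋖ᵖ-head {a = outside} {b = outside} _ = refl
⋖ᵖ-head {a = inside}  {b = outside} (_ , _ , agree) with proj₁ (agree zero λ ()) here
... | ()
⋖ᵖ-head {a = outside} {b = inside}  (_ , _ , agree) with proj₂ (agree zero λ ()) here
... | ()

⋖ᵖ-tail : ∀ {a b} {A B : Subset m} → (_∈ a ∷ A) ⋖ᵖ[ suc p ] (_∈ b ∷ B) → (_∈ A) ⋖ᵖ[ p ] (_∈ B)
⋖ᵖ-tail (p∉A , p∈B , agree) =
  (λ p∈A → p∉A (there p∈A)) , drop-there p∈B ,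
  λ k k≢p → let agreeₖ = agree (suc k) (λ e → k≢p (suc-injective e)) in
    (λ k∈A → drop-there (proj₁ agreeₖ (there k∈A))) , (λ k∈B → drop-there (proj₂ agreeₖ (there k∈B)))

⋖ᵖ⇒∣∣≡suc : {A B : Subset m} → (_∈ A) ⋖ᵖ[ p ] (_∈ B) → ∣ B ∣ ≡ suc ∣ A ∣
⋖ᵖ⇒∣∣≡suc {p = zero} {_ ∷ _} {_ ∷ _} A⋖B with ⋖ᵖ-zero A⋖B
... | refl , refl , refl = refl
⋖ᵖ⇒∣∣≡suc {p = suc p} {a ∷ A} {b ∷ B} A⋖B with ⋖ᵖ-head A⋖B
⋖ᵖ⇒∣∣≡suc {p = suc p} {inside ∷ A}  {inside ∷ B}  A⋖B | refl = cong suc (⋖ᵖ⇒∣∣≡suc (⋖ᵖ-tail A⋖B))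
⋖ᵖ⇒∣∣≡suc {p = suc p} {outside ∷ A} {outside ∷ B} A⋖B | refl = ⋖ᵖ⇒∣∣≡suc (⋖ᵖ-tail A⋖B)

⊆∧∣∣≡∸1⇒⋖ᵖ : {A B : Subset m} → A ⊆ B → ∣ A ∣ ≡ ∣ B ∣ ∸ 1 → A ≢ B →
             ∃ λ p → (_∈ A) ⋖ᵖ[ p ] (_∈ B)
⊆∧∣∣≡∸1⇒⋖ᵖ {A = A} {B} A⊆B ∣A∣≡∣B∣∸1 A≢B with any? (λ k → k ∈? B ×-dec ¬? (k ∈? A))
... | no ∄p = contradiction (⊆-antisym A⊆B B⊆A) A≢B
  where
  B⊆A : B ⊆ A
  B⊆A {k} k∈B with k ∈? A
  ... | yes k∈A = k∈A
  ... | no k∉A  = contradiction (k , k∈B , k∉A) ∄p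
... | yes (p , p∈B , p∉A) = p , p∉A , p∈B , λ k k≢p → A⊆B , B⊆A-off-p k k≢p
  where
  B⊆A-off-p : ∀ k → k ≢ p → k ∈ B → k ∈ A
  B⊆A-off-p k k≢p k∈B with k ∈? A
  ... | yes k∈A = k∈A
  ... | no k∉A  = contradiction ∣A∣≡∣B∣∸1 λ eq → ℕ.<-irrefl eq (ℕ.∸-monoˡ-≤ 1 2+∣A∣≤∣B∣)
    where
    open ℕ.≤-Reasoning
    A⊆B-p-k : A ⊆ B - p - k
    A⊆B-p-k {j} j∈A =
      x∈p∧x≢y⇒x∈p-y (x∈p∧x≢y⇒x∈p-y (A⊆B j∈A) λ { refl → p∉A j∈A }) λ { refl → k∉A j∈A }
    2+∣A∣≤∣B∣ : suc (suc ∣ A ∣) ≤ ∣ B ∣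
    2+∣A∣≤∣B∣ = begin
      suc (suc ∣ A ∣)         ≤⟨ s≤s (s≤s (p⊆q⇒∣p∣≤∣q∣ A⊆B-p-k)) ⟩
      suc (suc ∣ B - p - k ∣) ≤⟨ s≤s (x∈p⇒∣p-x∣<∣p∣ (x∈p∧x≢y⇒x∈p-y k∈B k≢p)) ⟩
      suc ∣ B - p ∣           ≤⟨ x∈p⇒∣p-x∣<∣p∣ p∈B ⟩
      ∣ B ∣                   ∎

module _ (a b : Fin n) where

  transpose-matchˡ : PC.transpose a b a ≡ b
  transpose-matchˡ rewrite dec-true (a ≟ a) refl = refl

  transpose-matchʳ : PC.transpose a b b ≡ a
  transpose-matchʳ with b ≟ a
  ... | yes b≡a = b≡a
  ... | no _ rewrite dec-true (b ≟ b) refl = refl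

  transpose-fixes : ∀ {c} → c ≢ a → c ≢ b → PC.transpose a b c ≡ c
  transpose-fixes {c} c≢a c≢b rewrite dec-false (c ≟ a) c≢a | dec-false (c ≟ b) c≢b = refl

  transpose-involutive : ∀ c → PC.transpose a b (PC.transpose a b c) ≡ c
  transpose-involutive c = by-cases (c ≟ a) (c ≟ b)
    where
    t = PC.transpose a b
    by-cases : Dec (c ≡ a) → Dec (c ≡ b) → t (t c) ≡ c
    by-cases (yes refl) _          = trans (cong t transpose-matchˡ) transpose-matchʳ
    by-cases (no _)     (yes refl) = trans (cong t transpose-matchʳ) transpose-matchˡ
    by-cases (no c≢a)   (no c≢b)   = trans (cong t (transpose-fixes c≢a c≢b)) (transpose-fixes c≢a c≢b)

s : Fin m → Fin (suc m) → Fin (suc m)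
s i = PC.transpose (inject₁ i) (suc i)

inject₁<suc : (i : Fin m) → inject₁ i < suc i
inject₁<suc i = ≤̄⇒inject₁< ≤-refl

module _ (i : Fin m) where

  private
    x y : Fin (suc m)
    x = inject₁ i
    y = suc i

  s-mono : ∀ {a b} → a < b → ¬ (a ≡ x × b ≡ y) → s i a < s i b
  s-mono {a} {b} a<b ¬xy = by-cases (a ≟ x) (a ≟ y) (b ≟ x) (b ≟ y)
    where
    via : ∀ {a′ b′} → s i a ≡ a′ → s i b ≡ b′ → a′ < b′ → s i a < s i b
    via sa≡a′ sb≡b′ = subst₂ _<_ (sym sa≡a′) (sym sb≡b′)
    by-cases : Dec (a ≡ x) → Dec (a ≡ y) → Dec (b ≡ x) → Dec (b ≡ y) → s i a < s i b
    by-cases (yes refl) _ _ _ =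
      via (transpose-matchˡ x y) (transpose-fixes x y (λ b≡x → <⇒≢ a<b (sym b≡x)) b≢y) y<b
      where
      b≢y : b ≢ y
      b≢y b≡y = ¬xy (refl , b≡y)
      y<b : y < b
      y<b = ≤∧≢⇒< (subst (λ v → suc v ℕ.≤ toℕ b) (toℕ-inject₁ i) a<b) (λ y≡b → b≢y (sym y≡b))
    by-cases (no _) (yes refl) _ _ =
      via (transpose-matchʳ x y) (transpose-fixes x y (λ b≡x → <⇒≢ x<b (sym b≡x)) (λ b≡y → <⇒≢ a<b (sym b≡y))) x<b
      where
      x<b : x < b
      x<b = <-trans (inject₁<suc i) a<b
    by-cases (no a≢x) (no a≢y) (yes refl) _ =
      via (transpose-fixes x y a≢x a≢y) (transpose-matchˡ x y) (<-trans a<b (inject₁<suc i))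
    by-cases (no a≢x) (no a≢y) (no _) (yes refl) =
      via (transpose-fixes x y a≢x a≢y) (transpose-matchʳ x y)
          (≤∧≢⇒< (subst (toℕ a ℕ.≤_) (sym (toℕ-inject₁ i)) (ℕ.≤-pred a<b)) a≢x)
    by-cases (no a≢x) (no a≢y) (no b≢x) (no b≢y) =
      via (transpose-fixes x y a≢x a≢y) (transpose-fixes x y b≢x b≢y) a<b

  s-reflects : ∀ {a b} → s i a < s i b → ¬ (a ≡ y × b ≡ x) → a < b
  s-reflects {a} {b} sa<sb ¬yx =
    subst₂ _<_ (transpose-involutive x y a) (transpose-involutive x y b) (s-mono sa<sb ¬xy)
    where
    moved : ∀ {c d} → s i c ≡ d → c ≡ s i d
    moved {c} sc≡d = trans (sym (transpose-involutive x y c)) (cong (s i) sc≡d)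
    ¬xy : ¬ (s i a ≡ x × s i b ≡ y)
    ¬xy (sa≡x , sb≡y) =
      ¬yx (trans (moved sa≡x) (transpose-matchˡ x y) , trans (moved sb≡y) (transpose-matchʳ x y))

⟨$⟩ʳ⇒⟨$⟩ˡ : (π : Permutation′ n) {a b : Fin n} → π ⟨$⟩ʳ a ≡ b → π ⟨$⟩ˡ b ≡ a
⟨$⟩ʳ⇒⟨$⟩ˡ π πa≡b = trans (cong (π ⟨$⟩ˡ_) (sym πa≡b)) (inverseˡ π)

⟨$⟩ʳ-injective : (π : Permutation′ n) {a b : Fin n} → π ⟨$⟩ʳ a ≡ π ⟨$⟩ʳ b → a ≡ b
⟨$⟩ʳ-injective π πa≡πb = trans (sym (⟨$⟩ʳ⇒⟨$⟩ˡ π refl)) (⟨$⟩ʳ⇒⟨$⟩ˡ π (sym πa≡πb))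

module _ (σ τ : Permutation′ (suc m)) (i : Fin m)
         (x-left-of-y : σ ⟨$⟩ˡ inject₁ i < σ ⟨$⟩ˡ suc i)
         (τ≗sσ : ∀ j → τ ⟨$⟩ʳ j ≡ s i (σ ⟨$⟩ʳ j)) where

  XYAt : Fin m → Set
  XYAt k = σ ⟨$⟩ʳ inject₁ k ≡ inject₁ i × σ ⟨$⟩ʳ suc k ≡ suc i

  descent-preserved : ∀ k → ¬ XYAt k →
                      (IsDescent σ k → IsDescent τ k) × (IsDescent τ k → IsDescent σ k)
  descent-preserved k ¬xy rewrite τ≗sσ (inject₁ k) | τ≗sσ (suc k) =
    (λ d → s-mono i d ¬yx) , (λ d → s-reflects i d λ (σk+1≡y , σk≡x) → ¬xy (σk≡x , σk+1≡y))
    where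
    ¬yx : ¬ (σ ⟨$⟩ʳ suc k ≡ inject₁ i × σ ⟨$⟩ʳ inject₁ k ≡ suc i)
    ¬yx (σk+1≡x , σk≡y) = <-asym x-left-of-y
      (subst₂ _<_ (sym (⟨$⟩ʳ⇒⟨$⟩ˡ σ σk≡y)) (sym (⟨$⟩ʳ⇒⟨$⟩ˡ σ σk+1≡x)) (inject₁<suc k))

  descents-⋖ᵖ : XYAt p → IsDescent σ ⋖ᵖ[ p ] IsDescent τ
  descents-⋖ᵖ {p = p} (σp≡x , σp+1≡y) = ascent-σ , descent-τ , λ k k≢p →
    descent-preserved k λ (σk≡x , _) → k≢p (inject₁-injective (⟨$⟩ʳ-injective σ (trans σk≡x (sym σp≡x))))
    where
    ascent-σ : ¬ IsDescent σ p
    ascent-σ rewrite σp≡x | σp+1≡y = <-asym (inject₁<suc i)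
    descent-τ : IsDescent τ p
    descent-τ rewrite τ≗sσ (inject₁ p) | τ≗sσ (suc p) | σp≡x | σp+1≡y =
      subst₂ _<_ (sym (transpose-matchʳ (inject₁ i) (suc i))) (sym (transpose-matchˡ (inject₁ i) (suc i)))
             (inject₁<suc i)

descent-classes-of-cover : {A B : Subset m} (σ τ : Permutation′ (suc m)) → σ ⋖ τ →
  InDescentClass A σ → InDescentClass B τ → A ≡ B ⊎ ∃ λ p → (_∈ A) ⋖ᵖ[ p ] (_∈ B)
descent-classes-of-cover σ τ (i , x-left-of-y , τ≗sσ) σ∈A τ∈B
  with any? (λ k → (σ ⟨$⟩ʳ inject₁ k ≟ inject₁ i) ×-dec (σ ⟨$⟩ʳ suc k ≟ suc i))
... | yes (p , xy) = inj₂ (p , ⋖ᵖ-resp-≐ (≐-sym σ∈A) (≐-sym τ∈B) (descents-⋖ᵖ σ τ i x-left-of-y τ≗sσ xy))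
... | no ∄p = inj₁ (≐⇒≡ (≐-trans σ∈A (≐-trans σ≐τ (≐-sym τ∈B))))
  where
  σ≐τ : IsDescent σ ≐ IsDescent τ
  σ≐τ k = descent-preserved σ τ i x-left-of-y τ≗sσ k λ xy → ∄p (k , xy)

cover⇒⊆∧∣∣≡∸1 : {A B : Subset m} (σ τ : Permutation′ (suc m)) → A ≢ B →
  InDescentClass A σ → InDescentClass B τ → σ ⋖ τ → A ⊆ B × ∣ A ∣ ≡ ∣ B ∣ ∸ 1
cover⇒⊆∧∣∣≡∸1 σ τ A≢B σ∈A τ∈B σ⋖τ with descent-classes-of-cover σ τ σ⋖τ σ∈A τ∈B
... | inj₁ A≡B       = contradiction A≡B A≢B
... | inj₂ (_ , A⋖B) = ⋖ᵖ⇒⊆ A⋖B , cong (_∸ 1) (sym (⋖ᵖ⇒∣∣≡suc A⋖B))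

-- Reading the word left to right, position k < m receives the largest remaining value if
-- k ∈ J and the smallest one otherwise.
canonical : Subset m → Permutation′ (suc m)
canonical []      = id
canonical (b ∷ J) = insert zero (extreme b) (canonical J)
  where
  extreme : Side → Fin (suc (suc _))
  extreme inside  = fromℕ _
  extreme outside = zero

offset : Side → ℕ
offset inside  = 0
offset outside = 1

toℕ-punchIn-fromℕ : (v : Fin n) → toℕ (punchIn (fromℕ n) v) ≡ toℕ v
toℕ-punchIn-fromℕ zero    = refl
toℕ-punchIn-fromℕ (suc v) = cong suc (toℕ-punchIn-fromℕ v)

canonical-suc : ∀ b (J : Subset m) k →
  toℕ (canonical (b ∷ J) ⟨$⟩ʳ suc k) ≡ offset b + toℕ (canonical J ⟨$⟩ʳ k)
canonical-suc inside  J k = toℕ-punchIn-fromℕ (canonical J ⟨$⟩ʳ k)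
canonical-suc outside J k = refl

canonical-descents : (J : Subset m) → InDescentClass J (canonical J)
canonical-descents (inside ∷ J) zero = (λ _ → first-is-max) , (λ _ → here)
  where
  first-is-max : IsDescent (canonical (inside ∷ J)) zero
  first-is-max = subst₂ ℕ._<_ (sym (canonical-suc inside J zero)) (sym (toℕ-fromℕ _)) (toℕ<n _)
canonical-descents (outside ∷ J) zero = (λ ()) , (λ ())
canonical-descents (b ∷ J) (suc k) =
  (λ k∈J → shifted (proj₁ (canonical-descents J k) (drop-there k∈J))) ,
  (λ d → there (proj₂ (canonical-descents J k) (unshifted d)))
  where
  shifted : IsDescent (canonical J) k → IsDescent (canonical (b ∷ J)) (suc k)
  shifted d = subst₂ ℕ._<_ (sym (canonical-suc b J (suc k))) (sym (canonical-suc b J (inject₁ k)))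
                           (ℕ.+-monoʳ-< (offset b) d)
  unshifted : IsDescent (canonical (b ∷ J)) (suc k) → IsDescent (canonical J) k
  unshifted d = ℕ.+-cancelˡ-< (offset b) _ _
    (subst₂ ℕ._<_ (canonical-suc b J (suc k)) (canonical-suc b J (inject₁ k)) d)

StartsWith : Side → Subset m → Set
StartsWith b []      = ⊤
StartsWith b (c ∷ _) = c ≡ b

Run : Side → Subset m → Fin m → Set
Run b (c ∷ J) zero    = c ≡ b × StartsWith b J
Run b (_ ∷ J) (suc p) = Run b J p

canonical-run-inside : (J : Subset m) (p : Fin m) → Run inside J p →
  toℕ (canonical J ⟨$⟩ʳ inject₁ p) ≡ suc (toℕ (canonical J ⟨$⟩ʳ suc p))
canonical-run-inside (inside ∷ [])         zero (refl , _)    = refl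
canonical-run-inside (inside ∷ inside ∷ J) zero (refl , refl) =
  trans (toℕ-fromℕ _) (cong suc (sym (trans (canonical-suc inside (inside ∷ J) zero) (toℕ-fromℕ _))))
canonical-run-inside (b ∷ J) (suc p) run = begin
  toℕ (canonical (b ∷ J) ⟨$⟩ʳ suc (inject₁ p))   ≡⟨ canonical-suc b J (inject₁ p) ⟩
  offset b + toℕ (canonical J ⟨$⟩ʳ inject₁ p)     ≡⟨ cong (offset b +_) (canonical-run-inside J p run) ⟩
  offset b + suc (toℕ (canonical J ⟨$⟩ʳ suc p))   ≡⟨ ℕ.+-suc (offset b) _ ⟩
  suc (offset b + toℕ (canonical J ⟨$⟩ʳ suc p))   ≡⟨ cong suc (canonical-suc b J (suc p)) ⟨
  suc (toℕ (canonical (b ∷ J) ⟨$⟩ʳ suc (suc p))) ∎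
  where open ≡-Reasoning

canonical-run-outside : (J : Subset m) (p : Fin m) → Run outside J p →
  toℕ (canonical J ⟨$⟩ʳ suc p) ≡ suc (toℕ (canonical J ⟨$⟩ʳ inject₁ p))
canonical-run-outside (outside ∷ [])          zero (refl , _)    = refl
canonical-run-outside (outside ∷ outside ∷ J) zero (refl , refl) = refl
canonical-run-outside (b ∷ J) (suc p) run = begin
  toℕ (canonical (b ∷ J) ⟨$⟩ʳ suc (suc p))           ≡⟨ canonical-suc b J (suc p) ⟩
  offset b + toℕ (canonical J ⟨$⟩ʳ suc p)             ≡⟨ cong (offset b +_) (canonical-run-outside J p run) ⟩
  offset b + suc (toℕ (canonical J ⟨$⟩ʳ inject₁ p))   ≡⟨ ℕ.+-suc (offset b) _ ⟩
  suc (offset b + toℕ (canonical J ⟨$⟩ʳ inject₁ p))   ≡⟨ cong suc (canonical-suc b J (inject₁ p)) ⟨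
  suc (toℕ (canonical (b ∷ J) ⟨$⟩ʳ suc (inject₁ p))) ∎
  where open ≡-Reasoning

⋖ᵖ⇒run : {A B : Subset m} → (_∈ A) ⋖ᵖ[ p ] (_∈ B) → Run inside B p ⊎ Run outside A p
⋖ᵖ⇒run {p = zero} {_ ∷ _} {_ ∷ _} A⋖B with ⋖ᵖ-zero A⋖B
⋖ᵖ⇒run {p = zero} {_ ∷ []}          A⋖B | refl , refl , refl = inj₁ (refl , _)
⋖ᵖ⇒run {p = zero} {_ ∷ inside ∷ _}  A⋖B | refl , refl , refl = inj₁ (refl , refl)
⋖ᵖ⇒run {p = zero} {_ ∷ outside ∷ _} A⋖B | refl , refl , refl = inj₂ (refl , refl)
⋖ᵖ⇒run {p = suc p} {_ ∷ _} {_ ∷ _} A⋖B = ⋖ᵖ⇒run (⋖ᵖ-tail A⋖B)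

adjacent-values : (a b : Fin (suc m)) → toℕ b ≡ suc (toℕ a) → ∃ λ i → a ≡ inject₁ i × b ≡ suc i
adjacent-values a (suc b) b≡1+a =
  b , toℕ-injective (trans (sym (ℕ.suc-injective b≡1+a)) (sym (toℕ-inject₁ b))) , refl

CoverBetween : Subset m → Subset m → Set
CoverBetween {m} A B = Σ (Permutation′ (suc m)) λ σ → Σ (Permutation′ (suc m)) λ τ →
  InDescentClass A σ × InDescentClass B τ × σ ⋖ τ

-- Knowing the descent class of one of σ, τ suffices: it determines the other.
swap-realizes-⋖ᵖ : {A B : Subset m} (σ τ : Permutation′ (suc m)) {i : Fin m} →
  (_∈ A) ⋖ᵖ[ p ] (_∈ B) → σ ⟨$⟩ʳ inject₁ p ≡ inject₁ i → σ ⟨$⟩ʳ suc p ≡ suc i →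
  (∀ j → τ ⟨$⟩ʳ j ≡ s i (σ ⟨$⟩ʳ j)) → InDescentClass A σ ⊎ InDescentClass B τ → CoverBetween A B
swap-realizes-⋖ᵖ {p = p} {A} {B} σ τ {i} A⋖B σp≡x σp+1≡y τ≗sσ known =
  σ , τ , proj₁ (classes known) , proj₂ (classes known) , (i , x-left-of-y , τ≗sσ)
  where
  x-left-of-y : σ ⟨$⟩ˡ inject₁ i < σ ⟨$⟩ˡ suc i
  x-left-of-y = subst₂ _<_ (sym (⟨$⟩ʳ⇒⟨$⟩ˡ σ σp≡x)) (sym (⟨$⟩ʳ⇒⟨$⟩ˡ σ σp+1≡y)) (inject₁<suc p)
  σ⋖τ : IsDescent σ ⋖ᵖ[ p ] IsDescent τ
  σ⋖τ = descents-⋖ᵖ σ τ i x-left-of-y τ≗sσ (σp≡x , σp+1≡y)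
  classes : InDescentClass A σ ⊎ InDescentClass B τ → InDescentClass A σ × InDescentClass B τ
  classes (inj₁ σ∈A) = σ∈A , ⋖ᵖ-determinesʳ A⋖B (⋖ᵖ-resp-≐ (≐-sym σ∈A) ≐-refl σ⋖τ)
  classes (inj₂ τ∈B) = ⋖ᵖ-determinesˡ A⋖B (⋖ᵖ-resp-≐ ≐-refl (≐-sym τ∈B) σ⋖τ) , τ∈B

⋖ᵖ⇒cover : {A B : Subset m} → (_∈ A) ⋖ᵖ[ p ] (_∈ B) → CoverBetween A B
⋖ᵖ⇒cover {p = p} {A} {B} A⋖B = [ from-descending-run , from-ascending-run ]′ (⋖ᵖ⇒run A⋖B)
  where
  from-ascending-run : Run outside A p → CoverBetween A B
  from-ascending-run run with adjacent-values _ _ (canonical-run-outside A p run)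
  ... | i , σp≡x , σp+1≡y =
    swap-realizes-⋖ᵖ σ (σ ∘ₚ transpose (inject₁ i) (suc i)) A⋖B σp≡x σp+1≡y (λ _ → refl)
                     (inj₁ (canonical-descents A))
    where
    σ = canonical A

  from-descending-run : Run inside B p → CoverBetween A B
  from-descending-run run with adjacent-values _ _ (canonical-run-inside B p run)
  ... | i , τp+1≡x , τp≡y = swap-realizes-⋖ᵖ σ τ A⋖B σp≡x σp+1≡y τ≗sσ (inj₂ (canonical-descents B))
    where
    τ = canonical B
    σ = τ ∘ₚ transpose (suc i) (inject₁ i)
    σp≡x : σ ⟨$⟩ʳ inject₁ p ≡ inject₁ i
    σp≡x = trans (cong (PC.transpose (suc i) (inject₁ i)) τp≡y) (transpose-matchˡ (suc i) (inject₁ i))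
    σp+1≡y : σ ⟨$⟩ʳ suc p ≡ suc i
    σp+1≡y = trans (cong (PC.transpose (suc i) (inject₁ i)) τp+1≡x) (transpose-matchʳ (suc i) (inject₁ i))
    τ≗sσ : ∀ j → τ ⟨$⟩ʳ j ≡ s i (σ ⟨$⟩ʳ j)
    τ≗sσ j = sym (PC.transpose-inverse (inject₁ i) (suc i))

lemma3p3 : (m : ℕ) → 2 ≤ suc m → (I J : Subset m) → I ≢ J →
    (Σ (Permutation′ (suc m)) λ u → Σ (Permutation′ (suc m)) λ v →
       InDescentClass I u × InDescentClass J v × ((u ⋖ v) ⊎ (v ⋖ u)))
    ⇔ ((I ⊆ J × ∣ I ∣ ≡ ∣ J ∣ ∸ 1) ⊎ (J ⊆ I × ∣ J ∣ ≡ ∣ I ∣ ∸ 1))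
lemma3p3 m _ I J I≢J = mk⇔
  (λ { (u , v , u∈I , v∈J , inj₁ u⋖v) → inj₁ (cover⇒⊆∧∣∣≡∸1 u v I≢J u∈I v∈J u⋖v)
     ; (u , v , u∈I , v∈J , inj₂ v⋖u) → inj₂ (cover⇒⊆∧∣∣≡∸1 v u (≢-sym I≢J) v∈J u∈I v⋖u) })
  (λ { (inj₁ (I⊆J , ∣I∣≡∣J∣∸1)) →
         let (u , v , u∈I , v∈J , u⋖v) = ⋖ᵖ⇒cover (proj₂ (⊆∧∣∣≡∸1⇒⋖ᵖ I⊆J ∣I∣≡∣J∣∸1 I≢J))
         in u , v , u∈I , v∈J , inj₁ u⋖v
     ; (inj₂ (J⊆I , ∣J∣≡∣I∣∸1)) →
         let (v , u , v∈J , u∈I , v⋖u) = ⋖ᵖ⇒cover (proj₂ (⊆∧∣∣≡∸1⇒⋖ᵖ J⊆I ∣J∣≡∣I∣∸1 (≢-sym I≢J)))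
         in u , v , u∈I , v∈J , inj₂ v⋖u })
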